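{- Let $\mathbb F$ be a field of characteristic zero and let $H=([n],E)$ be a hypergraph (multiple edges allowed, every edge of size at least $2$). Let $\overline{p_H}(x_1,\ldots,x_n)=\prod_{e\in E}\big(\sum_{i\in e}x_i\big)\in\mathbb F[x_1,\ldots,x_n]$. Then $AT(\overline{p_H})=\lceil\mathrm{ed}(H)\rceil+1$.
   Context: For a polynomial $p=\sum_\alpha c_\alpha x_1^{\alpha_1}\cdots x_n^{\alpha_n}$, let $S(p)=\{\alpha:\sum_i\alpha_i=\deg p,\ c_\alpha\neq0\}$; the Alon--Tarsi number is $AT(p)=\min_{\alpha\in S(p)}\max\{\alpha_1,\ldots,\alpha_n\}+1$. The edge density is $\mathrm{ed}(H)=\max_{\emptyset\neq X\subseteq V}|E(X)|/|X|$, where $E(X)=\{e\in E:e\subseteq X\}$ (counted with multiplicity). -}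

module Defs where

open import Level using (Level)
open import Algebra.Bundles using (CommutativeRing)
open import Data.Nat as ℕ using (ℕ; zero; suc; _≤_)
open import Data.Nat.Base using (≢-nonZero)
open import Data.List.Relation.Unary.All using (All)
open import Data.Integer as ℤ using (ℤ; +_)
open import Data.Rational as ℚ using (ℚ)
open import Data.Fin using (Fin)
open import Data.Fin.Subset using (Subset; _⊆_; _∈_; ∣_∣)
open import Data.Fin.Subset.Properties using (_⊆?_; _∈?_)
open import Data.Vec as V using (Vec)
open import Data.Vec.Properties using (≡-dec)
open import Data.List as L using (List; []; _∷_; length; filter; allFin)
open import Data.Product using (Σ; _×_; _,_; ∃)
open import Relation.Nullary using (¬_; yes; no)
open import Relation.Binary.PropositionalEquality using (_≡_; _≢_)

module _ {c ℓ : Level} (R : CommutativeRing c ℓ) where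
  open CommutativeRing R

  natToR : ℕ → Carrier
  natToR zero    = 0#
  natToR (suc n) = 1# + natToR n

  IsField : Set (c Level.⊔ ℓ)
  IsField = (¬ (1# ≈ 0#)) × (∀ x → ¬ (x ≈ 0#) → ∃ λ y → (x * y) ≈ 1#)

  CharZero : Set ℓ
  CharZero = ∀ n → ¬ (natToR (suc n) ≈ 0#)

-- Polynomials in n variables over R, as finite lists of terms
-- (coefficient, exponent vector); the coefficient of x^α is the sum of
-- the coefficients of all terms with exponent α.

Exponent : ℕ → Set
Exponent n = Vec ℕ n

module Poly {c ℓ : Level} (R : CommutativeRing c ℓ) where
  open CommutativeRing R

  Poly : ℕ → Set c
  Poly n = List (Carrier × Exponent n)

  coeff : ∀ {n} → Poly n → Exponent n → Carrier
  coeff []            α = 0#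
  coeff ((a , β) ∷ p) α with ≡-dec ℕ._≟_ β α
  ... | yes _ = a + coeff p α
  ... | no  _ = coeff p α

  totalDeg : ∀ {n} → Exponent n → ℕ
  totalDeg α = V.sum α

  maxExp : ∀ {n} → Exponent n → ℕ
  maxExp α = V.foldr _ ℕ._⊔_ 0 α

  one : ∀ {n} → Poly n
  one = (1# , V.replicate _ 0) ∷ []

  var : ∀ {n} → Fin n → Poly n
  var i = (1# , V.updateAt (V.replicate _ 0) i (λ _ → 1)) ∷ []

  _⊕_ : ∀ {n} → Poly n → Poly n → Poly n
  p ⊕ q = p L.++ q

  _⊗_ : ∀ {n} → Poly n → Poly n → Poly n
  p ⊗ q = L.concatMap (λ { (a , α) → L.map (λ { (b , β) → (a * b , V.zipWith ℕ._+_ α β) }) q }) p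

  sumP : ∀ {n} → List (Poly n) → Poly n
  sumP = L.foldr _⊕_ []

  prodP : ∀ {n} → List (Poly n) → Poly n
  prodP = L.foldr _⊗_ one

  IsDeg : ∀ {n} → Poly n → ℕ → Set ℓ
  IsDeg p d = (∃ λ α → totalDeg α ≡ d × ¬ (coeff p α ≈ 0#))
            × (∀ α → ¬ (coeff p α ≈ 0#) → totalDeg α ≤ d)

  InS : ∀ {n} → Poly n → ℕ → Exponent n → Set ℓ
  InS p d α = (totalDeg α ≡ d) × ¬ (coeff p α ≈ 0#)

  IsAT : ∀ {n} → Poly n → ℕ → Set ℓ
  IsAT p a = Σ ℕ λ d → IsDeg p d
           × (∃ λ α → InS p d α × suc (maxExp α) ≡ a)
           × (∀ α → InS p d α → a ≤ suc (maxExp α))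

record Hypergraph (n : ℕ) : Set where
  field
    edges     : List (Subset n)
    edgesBig  : All (λ e → 2 ≤ ∣ e ∣) edges

eCount : ∀ {n} → Hypergraph n → Subset n → ℕ
eCount H X = length (filter (_⊆? X) (Hypergraph.edges H))

frac : ℕ → (b : ℕ) → b ≢ 0 → ℚ
frac a b b≢0 = ℚ._/_ (+ a) b {{≢-nonZero b≢0}}

IsEd : ∀ {n} → Hypergraph n → ℚ → Set
IsEd H q = (∃ λ X → Σ (∣ X ∣ ≢ 0) λ ne → frac (eCount H X) ∣ X ∣ ne ≡ q)
         × (∀ X (ne : ∣ X ∣ ≢ 0) → frac (eCount H X) ∣ X ∣ ne ℚ.≤ q)

module _ {c ℓ : Level} (R : CommutativeRing c ℓ) where
  open Poly R

  linForm : ∀ {n} → Subset n → Poly n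
  linForm e = sumP (L.map var (filter (_∈? e) (allFin _)))

  pbar : ∀ {n} → Hypergraph n → Poly n
  pbar H = prodP (L.map linForm (Hypergraph.edges H))

-- Expanding the product, a monomial of p̄_H arises from choosing one vertex in every edge, that
-- is, from an orientation of H, and its exponent is the in-degree vector of the orientation.
-- All coefficients are therefore positive integers, so in characteristic zero S(p̄_H) is the set
-- of in-degree vectors, and AT(p̄_H) - 1 is the least maximum in-degree of an orientation.
-- An orientation with maximum in-degree M sends every edge inside X to a head in X, so
-- |E(X)| ≤ M |X| for all X, whence M ≥ ⌈ed(H)⌉. Conversely, with K = ⌈ed(H)⌉ we have the Hall
-- condition |E(X)| ≤ K |X| for all X, and edges can be oriented one at a time: call X tight if
-- the remaining capacity of X is exhausted by the edges inside X, and orient the next edge e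
-- towards a vertex lying in no tight set. Such a vertex exists, since X ↦ |E(X)| is supermodular
-- and the capacity is modular, so tight sets are closed under union; if every vertex of e were
-- in a tight set, their union would be a tight set containing e, against the Hall condition.
module Submission where

open import Defs
open import Level using (Level)
open import Algebra.Bundles using (CommutativeRing)

module Orientations where

  open import Data.Nat as ℕ using (ℕ; zero; suc; _+_; _*_; _≤_; _<_; _≤?_; z≤n; s≤s; s≤s⁻¹)
  open import Data.Nat.Properties
  open import Algebra.Properties.CommutativeSemigroup +-commutativeSemigroup
    using (interchange; x∙yz≈y∙xz)
  open import Data.Fin using (Fin; zero; suc)
  open import Data.Fin.Properties using (any?)
  open import Data.Fin.Subset using (Subset; inside; outside; _∈_; _∉_; _⊆_; _∪_; _∩_; ⊥; ⊤; ⁅_⁆; ∣_∣)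
  open import Data.Fin.Subset.Properties
    using (_⊆?_; _∈?_; anySubset?; ∈⊤; x∈p∪q⁺; x∈p∩q⁺; x∈⁅x⁆; p⊆p∪q; q⊆p∪q; p⊆q⇒∣p∣≤∣q∣)
  open import Data.Vec as V using (Vec; []; _∷_; lookup; replicate; zipWith; here; there)
  open import Data.Vec.Properties using (zipWith-identityˡ)
  open import Data.Vec.Relation.Binary.Pointwise.Inductive as Pointwiseᵛ using ([]; _∷_)
  open import Data.List as L using (List; []; _∷_; length; filter; allFin)
  open import Data.List.Properties using (filter-accept)
  open import Data.List.Relation.Binary.Pointwise using (Pointwise; []; _∷_)
  open import Data.List.Relation.Unary.All as All using (All; []; _∷_)
  open import Data.List.Relation.Unary.All.Properties using (all-filter)
  open import Data.List.Membership.Propositional.Properties using (∈-filter⁺; ∈-allFin)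
  open import Data.Product using (∃; _×_; _,_; proj₁; proj₂)
  open import Data.Sum using (inj₁; inj₂)
  open import Data.Empty using (⊥-elim)
  open import Function using (_∘_)
  open import Relation.Nullary using (¬_; yes; no; Dec; contradiction)
  open import Relation.Nullary.Decidable using (_×-dec_; ¬?; decidable-stable)
  open import Relation.Binary.PropositionalEquality

  private variable
    n : ℕ

  infixl 6 _+ᵛ_
  infix  4 _≤ᵛ_

  _+ᵛ_ : Vec ℕ n → Vec ℕ n → Vec ℕ n
  _+ᵛ_ = zipWith _+_

  _≤ᵛ_ : Vec ℕ n → Vec ℕ n → Set
  _≤ᵛ_ = Pointwiseᵛ.Pointwise _≤_

  -- written exactly as the exponent vector in Poly.var, so that the two agree definitionally
  unit : Fin n → Vec ℕ n
  unit v = V.updateAt (replicate _ 0) v (λ _ → 1)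

  0≤ᵛ : (c : Vec ℕ n) → replicate n 0 ≤ᵛ c
  0≤ᵛ []      = []
  0≤ᵛ (_ ∷ c) = z≤n ∷ 0≤ᵛ c

  +ᵛ-monoʳ-≤ᵛ : (a : Vec ℕ n) {b c : Vec ℕ n} → b ≤ᵛ c → a +ᵛ b ≤ᵛ a +ᵛ c
  +ᵛ-monoʳ-≤ᵛ []      []          = []
  +ᵛ-monoʳ-≤ᵛ (x ∷ a) (y≤z ∷ b≤c) = +-monoʳ-≤ x y≤z ∷ +ᵛ-monoʳ-≤ᵛ a b≤c

  split-unit : (c : Vec ℕ n) (v : Fin n) → 0 < lookup c v → ∃ λ c′ → c ≡ unit v +ᵛ c′
  split-unit (suc x ∷ c) zero    _   = x ∷ c , cong (suc x ∷_) (sym (zipWith-identityˡ +-identityˡ c))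
  split-unit (x ∷ c)     (suc v) 0<cᵥ with split-unit c v 0<cᵥ
  ... | c′ , c≡ = x ∷ c′ , cong (x ∷_) c≡

  maxEntry : Vec ℕ n → ℕ
  maxEntry = V.foldr _ ℕ._⊔_ 0

  maxEntry-≤⇒≤ᵛ : (α : Vec ℕ n) {k : ℕ} → maxEntry α ≤ k → α ≤ᵛ replicate n k
  maxEntry-≤⇒≤ᵛ []      _   = []
  maxEntry-≤⇒≤ᵛ (x ∷ α) m≤k = ≤-trans (m≤m⊔n x _) m≤k ∷ maxEntry-≤⇒≤ᵛ α (≤-trans (m≤n⊔m x _) m≤k)

  ≤ᵛ⇒maxEntry-≤ : {α : Vec ℕ n} {k : ℕ} → α ≤ᵛ replicate n k → maxEntry α ≤ k
  ≤ᵛ⇒maxEntry-≤ []          = z≤n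
  ≤ᵛ⇒maxEntry-≤ (x≤k ∷ α≤k) = ⊔-lub x≤k (≤ᵛ⇒maxEntry-≤ α≤k)

  sumOver : Vec ℕ n → Subset n → ℕ
  sumOver []      []            = 0
  sumOver (x ∷ c) (inside ∷ X)  = x + sumOver c X
  sumOver (x ∷ c) (outside ∷ X) = sumOver c X

  sumOver-+ᵛ : (a b : Vec ℕ n) (X : Subset n) → sumOver (a +ᵛ b) X ≡ sumOver a X + sumOver b X
  sumOver-+ᵛ []      []      []            = refl
  sumOver-+ᵛ (x ∷ a) (y ∷ b) (inside ∷ X)  = begin
    (x + y) + sumOver (a +ᵛ b) X           ≡⟨ cong ((x + y) +_) (sumOver-+ᵛ a b X) ⟩
    (x + y) + (sumOver a X + sumOver b X)  ≡⟨ interchange x y _ _ ⟩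
    (x + sumOver a X) + (y + sumOver b X)  ∎
    where open ≡-Reasoning
  sumOver-+ᵛ (x ∷ a) (y ∷ b) (outside ∷ X) = sumOver-+ᵛ a b X

  sumOver-replicate : (k : ℕ) (X : Subset n) → sumOver (replicate n k) X ≡ k * ∣ X ∣
  sumOver-replicate k []            = sym (*-zeroʳ k)
  sumOver-replicate k (inside ∷ X)  = trans (cong (k +_) (sumOver-replicate k X)) (sym (*-suc k _))
  sumOver-replicate k (outside ∷ X) = sumOver-replicate k X

  sumOver-⊥ : (c : Vec ℕ n) → sumOver c ⊥ ≡ 0
  sumOver-⊥ []      = refl
  sumOver-⊥ (_ ∷ c) = sumOver-⊥ c

  sumOver-⊤ : (c : Vec ℕ n) → sumOver c ⊤ ≡ V.sum c
  sumOver-⊤ []      = refl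
  sumOver-⊤ (x ∷ c) = cong (x +_) (sumOver-⊤ c)

  sumOver-⁅⁆ : (c : Vec ℕ n) (v : Fin n) → sumOver c ⁅ v ⁆ ≡ lookup c v
  sumOver-⁅⁆ (x ∷ c) zero    = trans (cong (x +_) (sumOver-⊥ c)) (+-identityʳ x)
  sumOver-⁅⁆ (x ∷ c) (suc v) = sumOver-⁅⁆ c v

  sumOver-unit-∈ : {v : Fin n} {X : Subset n} → v ∈ X → sumOver (unit v) X ≡ 1
  sumOver-unit-∈ {v = zero}  {_ ∷ X}       here        = cong suc (sumOver-replicate 0 X)
  sumOver-unit-∈ {v = suc v} {inside ∷ X}  (there v∈X) = sumOver-unit-∈ v∈X
  sumOver-unit-∈ {v = suc v} {outside ∷ X} (there v∈X) = sumOver-unit-∈ v∈X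

  sumOver-unit-∉ : {v : Fin n} {X : Subset n} → v ∉ X → sumOver (unit v) X ≡ 0
  sumOver-unit-∉ {v = zero}  {inside ∷ X}  v∉X = contradiction here v∉X
  sumOver-unit-∉ {v = zero}  {outside ∷ X} v∉X = sumOver-replicate 0 X
  sumOver-unit-∉ {v = suc v} {inside ∷ X}  v∉X = sumOver-unit-∉ (v∉X ∘ there)
  sumOver-unit-∉ {v = suc v} {outside ∷ X} v∉X = sumOver-unit-∉ (v∉X ∘ there)

  sumOver-mono : {a b : Vec ℕ n} → a ≤ᵛ b → (X : Subset n) → sumOver a X ≤ sumOver b X
  sumOver-mono []          []            = z≤n
  sumOver-mono (x≤y ∷ a≤b) (inside ∷ X)  = +-mono-≤ x≤y (sumOver-mono a≤b X)
  sumOver-mono (x≤y ∷ a≤b) (outside ∷ X) = sumOver-mono a≤b X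

  sumOver-modular : (c : Vec ℕ n) (X Y : Subset n) →
                    sumOver c (X ∪ Y) + sumOver c (X ∩ Y) ≡ sumOver c X + sumOver c Y
  sumOver-modular []      []            []            = refl
  sumOver-modular (x ∷ c) (inside ∷ X)  (inside ∷ Y)  = begin
    (x + sumOver c (X ∪ Y)) + (x + sumOver c (X ∩ Y)) ≡⟨ interchange x _ x _ ⟩
    (x + x) + (sumOver c (X ∪ Y) + sumOver c (X ∩ Y)) ≡⟨ cong ((x + x) +_) (sumOver-modular c X Y) ⟩
    (x + x) + (sumOver c X + sumOver c Y)             ≡⟨ interchange x x _ _ ⟩
    (x + sumOver c X) + (x + sumOver c Y)             ∎
    where open ≡-Reasoning
  sumOver-modular (x ∷ c) (inside ∷ X)  (outside ∷ Y) = begin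
    (x + sumOver c (X ∪ Y)) + sumOver c (X ∩ Y) ≡⟨ +-assoc x _ _ ⟩
    x + (sumOver c (X ∪ Y) + sumOver c (X ∩ Y)) ≡⟨ cong (x +_) (sumOver-modular c X Y) ⟩
    x + (sumOver c X + sumOver c Y)             ≡⟨ +-assoc x _ _ ⟨
    (x + sumOver c X) + sumOver c Y             ∎
    where open ≡-Reasoning
  sumOver-modular (x ∷ c) (outside ∷ X) (inside ∷ Y)  = begin
    (x + sumOver c (X ∪ Y)) + sumOver c (X ∩ Y) ≡⟨ +-assoc x _ _ ⟩
    x + (sumOver c (X ∪ Y) + sumOver c (X ∩ Y)) ≡⟨ cong (x +_) (sumOver-modular c X Y) ⟩
    x + (sumOver c X + sumOver c Y)             ≡⟨ x∙yz≈y∙xz x (sumOver c X) (sumOver c Y) ⟩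
    sumOver c X + (x + sumOver c Y)             ∎
    where open ≡-Reasoning
  sumOver-modular (x ∷ c) (outside ∷ X) (outside ∷ Y) = sumOver-modular c X Y

  edgeCount : List (Subset n) → Subset n → ℕ
  edgeCount es X = length (filter (_⊆? X) es)

  𝟙[_⊆_] : Subset n → Subset n → ℕ
  𝟙[ e ⊆ X ] with e ⊆? X
  ... | yes _ = 1
  ... | no  _ = 0

  edgeCount-∷ : (e : Subset n) (es : List (Subset n)) (X : Subset n) →
                edgeCount (e ∷ es) X ≡ 𝟙[ e ⊆ X ] + edgeCount es X
  edgeCount-∷ e es X with e ⊆? X
  ... | yes _ = refl
  ... | no  _ = refl

  edgeCount-∷-≤ : (e : Subset n) (es : List (Subset n)) (X : Subset n) →
                  edgeCount es X ≤ edgeCount (e ∷ es) X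
  edgeCount-∷-≤ e es X rewrite edgeCount-∷ e es X = m≤n+m _ _

  edgeCount-∷-⊆ : {e : Subset n} (es : List (Subset n)) {X : Subset n} →
                  e ⊆ X → edgeCount (e ∷ es) X ≡ suc (edgeCount es X)
  edgeCount-∷-⊆ es e⊆X = cong length (filter-accept (_⊆? _) e⊆X)

  ∣X∣≡0⇒edgeCount≡0 : {es : List (Subset n)} {X : Subset n} →
                   All (λ e → 0 < ∣ e ∣) es → ∣ X ∣ ≡ 0 → edgeCount es X ≡ 0
  ∣X∣≡0⇒edgeCount≡0 []                               _      = refl
  ∣X∣≡0⇒edgeCount≡0 {es = e ∷ es} {X} (0<∣e∣ ∷ 0<∣es∣) ∣X∣≡0 with e ⊆? X
  ... | yes e⊆X = contradiction (subst (∣ e ∣ ≤_) ∣X∣≡0 (p⊆q⇒∣p∣≤∣q∣ e⊆X)) (<⇒≱ 0<∣e∣)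
  ... | no  _   = ∣X∣≡0⇒edgeCount≡0 0<∣es∣ ∣X∣≡0

  𝟙[⊆]-supermodular : (e X Y : Subset n) →
                      𝟙[ e ⊆ X ] + 𝟙[ e ⊆ Y ] ≤ 𝟙[ e ⊆ X ∪ Y ] + 𝟙[ e ⊆ X ∩ Y ]
  𝟙[⊆]-supermodular e X Y with e ⊆? X | e ⊆? Y | e ⊆? X ∪ Y | e ⊆? X ∩ Y
  ... | yes _   | yes _   | yes _  | yes _  = ≤-refl
  ... | yes e⊆X | yes e⊆Y | _      | no e⊈∩ = ⊥-elim (e⊈∩ λ x∈e → x∈p∩q⁺ (e⊆X x∈e , e⊆Y x∈e))
  ... | yes e⊆X | _       | no e⊈∪ | _      = ⊥-elim (e⊈∪ λ x∈e → p⊆p∪q Y (e⊆X x∈e))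
  ... | _       | yes e⊆Y | no e⊈∪ | _      = ⊥-elim (e⊈∪ λ x∈e → q⊆p∪q X Y (e⊆Y x∈e))
  ... | yes _   | no _    | yes _  | _      = s≤s z≤n
  ... | no _    | yes _   | yes _  | _      = s≤s z≤n
  ... | no _    | no _    | _      | _      = z≤n

  edgeCount-supermodular : (es : List (Subset n)) (X Y : Subset n) →
    edgeCount es X + edgeCount es Y ≤ edgeCount es (X ∪ Y) + edgeCount es (X ∩ Y)
  edgeCount-supermodular []       X Y = z≤n
  edgeCount-supermodular (e ∷ es) X Y
    rewrite edgeCount-∷ e es X | edgeCount-∷ e es Y | edgeCount-∷ e es (X ∪ Y) | edgeCount-∷ e es (X ∩ Y) =
    begin
      (𝟙[ e ⊆ X ] + edgeCount es X) + (𝟙[ e ⊆ Y ] + edgeCount es Y)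
        ≡⟨ interchange 𝟙[ e ⊆ X ] _ _ _ ⟩
      (𝟙[ e ⊆ X ] + 𝟙[ e ⊆ Y ]) + (edgeCount es X + edgeCount es Y)
        ≤⟨ +-mono-≤ (𝟙[⊆]-supermodular e X Y) (edgeCount-supermodular es X Y) ⟩
      (𝟙[ e ⊆ X ∪ Y ] + 𝟙[ e ⊆ X ∩ Y ]) + (edgeCount es (X ∪ Y) + edgeCount es (X ∩ Y))
        ≡⟨ interchange 𝟙[ e ⊆ X ∪ Y ] _ _ _ ⟩
      (𝟙[ e ⊆ X ∪ Y ] + edgeCount es (X ∪ Y)) + (𝟙[ e ⊆ X ∩ Y ] + edgeCount es (X ∩ Y))
    ∎
    where open ≤-Reasoning

  Orientation : List (Subset n) → List (Fin n) → Set
  Orientation = Pointwise (λ e v → v ∈ e)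

  indeg : List (Fin n) → Vec ℕ n
  indeg []       = replicate _ 0
  indeg (v ∷ vs) = unit v +ᵛ indeg vs

  sum-indeg : (vs : List (Fin n)) → V.sum (indeg vs) ≡ length vs
  sum-indeg {n} []   = trans (sym (sumOver-⊤ (replicate n 0))) (sumOver-replicate 0 (⊤ {n}))
  sum-indeg (v ∷ vs) = begin
    V.sum (unit v +ᵛ indeg vs)                ≡⟨ sumOver-⊤ (unit v +ᵛ indeg vs) ⟨
    sumOver (unit v +ᵛ indeg vs) ⊤            ≡⟨ sumOver-+ᵛ (unit v) (indeg vs) ⊤ ⟩
    sumOver (unit v) ⊤ + sumOver (indeg vs) ⊤ ≡⟨ cong₂ _+_ (sumOver-unit-∈ {v = v} ∈⊤) (sumOver-⊤ (indeg vs)) ⟩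
    suc (V.sum (indeg vs))                    ≡⟨ cong suc (sum-indeg vs) ⟩
    suc (length vs)                           ∎
    where open ≡-Reasoning

  𝟙[⊆]-≤-unit : {e : Subset n} {v : Fin n} → v ∈ e → (X : Subset n) → 𝟙[ e ⊆ X ] ≤ sumOver (unit v) X
  𝟙[⊆]-≤-unit {e = e} v∈e X with e ⊆? X
  ... | yes e⊆X = ≤-reflexive (sym (sumOver-unit-∈ (e⊆X v∈e)))
  ... | no  _   = z≤n

  edgeCount-≤-indeg : {es : List (Subset n)} {vs : List (Fin n)} → Orientation es vs →
                      (X : Subset n) → edgeCount es X ≤ sumOver (indeg vs) X
  edgeCount-≤-indeg []                                      X = z≤n
  edgeCount-≤-indeg {es = e ∷ es} {v ∷ vs} (v∈e ∷ orient) X = begin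
    edgeCount (e ∷ es) X                      ≡⟨ edgeCount-∷ e es X ⟩
    𝟙[ e ⊆ X ] + edgeCount es X               ≤⟨ +-mono-≤ (𝟙[⊆]-≤-unit v∈e X) (edgeCount-≤-indeg orient X) ⟩
    sumOver (unit v) X + sumOver (indeg vs) X ≡⟨ sumOver-+ᵛ (unit v) (indeg vs) X ⟨
    sumOver (indeg (v ∷ vs)) X                ∎
    where open ≤-Reasoning

  edgeCount-≤-maxIndeg : {es : List (Subset n)} {vs : List (Fin n)} → Orientation es vs →
                         (X : Subset n) → edgeCount es X ≤ maxEntry (indeg vs) * ∣ X ∣
  edgeCount-≤-maxIndeg {es = es} {vs} orient X = begin
    edgeCount es X                                ≤⟨ edgeCount-≤-indeg orient X ⟩
    sumOver (indeg vs) X                          ≤⟨ sumOver-mono (maxEntry-≤⇒≤ᵛ (indeg vs) ≤-refl) X ⟩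
    sumOver (replicate _ (maxEntry (indeg vs))) X ≡⟨ sumOver-replicate _ X ⟩
    maxEntry (indeg vs) * ∣ X ∣                   ∎
    where open ≤-Reasoning

  HallCondition : List (Subset n) → Vec ℕ n → Set
  HallCondition es c = ∀ X → edgeCount es X ≤ sumOver c X

  Tight : List (Subset n) → Vec ℕ n → Subset n → Set
  Tight es c X = sumOver c X ≤ edgeCount es X

  InTightSet : List (Subset n) → Vec ℕ n → Fin n → Set
  InTightSet es c v = ∃ λ X → v ∈ X × Tight es c X

  inTightSet? : (es : List (Subset n)) (c : Vec ℕ n) (v : Fin n) → Dec (InTightSet es c v)
  inTightSet? es c v = anySubset? (λ X → v ∈? X ×-dec sumOver c X ≤? edgeCount es X)

  module _ (es : List (Subset n)) (c : Vec ℕ n) where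

    tight-⊥ : Tight es c ⊥
    tight-⊥ = subst (_≤ edgeCount es ⊥) (sym (sumOver-⊥ c)) z≤n

    tight-∪ : HallCondition es c → {X Y : Subset n} → Tight es c X → Tight es c Y → Tight es c (X ∪ Y)
    tight-∪ hall {X} {Y} tX tY = +-cancelʳ-≤ (sumOver c (X ∩ Y)) _ _ (begin
      sumOver c (X ∪ Y) + sumOver c (X ∩ Y)       ≡⟨ sumOver-modular c X Y ⟩
      sumOver c X + sumOver c Y                   ≤⟨ +-mono-≤ tX tY ⟩
      edgeCount es X + edgeCount es Y             ≤⟨ edgeCount-supermodular es X Y ⟩
      edgeCount es (X ∪ Y) + edgeCount es (X ∩ Y) ≤⟨ +-monoʳ-≤ _ (hall (X ∩ Y)) ⟩
      edgeCount es (X ∪ Y) + sumOver c (X ∩ Y)    ∎)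
      where open ≤-Reasoning

    tight-cover : HallCondition es c → {vs : List (Fin n)} → All (InTightSet es c) vs →
                  ∃ λ U → Tight es c U × All (_∈ U) vs
    tight-cover hall []                      = ⊥ , tight-⊥ , []
    tight-cover hall ((X , v∈X , tX) ∷ rest) with tight-cover hall rest
    ... | U , tU , rest⊆U =
      U ∪ X , tight-∪ hall tU tX , x∈p∪q⁺ (inj₂ v∈X) ∷ All.map (x∈p∪q⁺ ∘ inj₁) rest⊆U

  module _ (e : Subset n) (es : List (Subset n)) where

    hallCondition-∷⁻ : (c : Vec ℕ n) → HallCondition (e ∷ es) c → HallCondition es c
    hallCondition-∷⁻ c hall X = ≤-trans (edgeCount-∷-≤ e es X) (hall X)

    edge-not-covered-by-tight-sets : (c : Vec ℕ n) → HallCondition (e ∷ es) c →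
                                     ¬ (∀ v → v ∈ e → InTightSet es c v)
    edge-not-covered-by-tight-sets c hall covered
      with tight-cover es c (hallCondition-∷⁻ c hall) (All.map (covered _) (all-filter (_∈? e) (allFin n)))
    ... | U , tU , vertices⊆U = 1+n≰n (begin
      suc (edgeCount es U) ≡⟨ edgeCount-∷-⊆ es e⊆U ⟨
      edgeCount (e ∷ es) U ≤⟨ hall U ⟩
      sumOver c U          ≤⟨ tU ⟩
      edgeCount es U       ∎)
      where
      open ≤-Reasoning
      e⊆U : e ⊆ U
      e⊆U v∈e = All.lookup vertices⊆U (∈-filter⁺ (_∈? e) (∈-allFin _) v∈e)

    hallCondition-orient : (c : Vec ℕ n) (v : Fin n) → HallCondition (e ∷ es) (unit v +ᵛ c) →
                           ¬ InTightSet es (unit v +ᵛ c) v → HallCondition es c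
    hallCondition-orient c v hall free X with v ∈? X
    ... | yes v∈X = s≤s⁻¹ (begin-strict
      edgeCount es X                   <⟨ ≰⇒> (λ t → free (X , v∈X , t)) ⟩
      sumOver (unit v +ᵛ c) X          ≡⟨ sumOver-+ᵛ (unit v) c X ⟩
      sumOver (unit v) X + sumOver c X ≡⟨ cong (_+ sumOver c X) (sumOver-unit-∈ v∈X) ⟩
      suc (sumOver c X)                ∎)
      where open ≤-Reasoning
    ... | no v∉X = begin
      edgeCount es X                   ≤⟨ hallCondition-∷⁻ (unit v +ᵛ c) hall X ⟩
      sumOver (unit v +ᵛ c) X          ≡⟨ sumOver-+ᵛ (unit v) c X ⟩
      sumOver (unit v) X + sumOver c X ≡⟨ cong (_+ sumOver c X) (sumOver-unit-∉ v∉X) ⟩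
      sumOver c X                      ∎
      where open ≤-Reasoning

  ¬inTightSet⇒0<lookup : (es : List (Subset n)) (c : Vec ℕ n) (v : Fin n) →
                         ¬ InTightSet es c v → 0 < lookup c v
  ¬inTightSet⇒0<lookup es c v free =
    subst (0 <_) (sumOver-⁅⁆ c v) (≤-<-trans z≤n (≰⇒> λ t → free (⁅ v ⁆ , x∈⁅x⁆ v , t)))

  hallCondition⇒orientation : (es : List (Subset n)) (c : Vec ℕ n) → HallCondition es c →
                              ∃ λ vs → Orientation es vs × indeg vs ≤ᵛ c
  hallCondition⇒orientation []       c _    = [] , [] , 0≤ᵛ c
  hallCondition⇒orientation (e ∷ es) c hall with any? (λ v → v ∈? e ×-dec ¬? (inTightSet? es c v))
  ... | no none = contradiction
    (λ v v∈e → decidable-stable (inTightSet? es c v) (λ free → none (v , v∈e , free)))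
    (edge-not-covered-by-tight-sets e es c hall)
  ... | yes (v , v∈e , free) with split-unit c v (¬inTightSet⇒0<lookup es c v free)
  ...   | c′ , refl with hallCondition⇒orientation es c′ (hallCondition-orient e es c′ v hall free)
  ...     | vs , orient , vs≤c′ = v ∷ vs , v∈e ∷ orient , +ᵛ-monoʳ-≤ᵛ (unit v) vs≤c′

module CeilingDivision where

  open import Data.Nat as ℕ using (ℕ; zero; suc; _*_; _≤_; _/_; _%_; NonZero; ≢-nonZero⁻¹; s≤s)
  open import Data.Nat.Properties
  open import Data.Nat.DivMod using (m≡m%n+[m/n]*n; m%n<n)
  open import Data.Nat.Coprimality using (Coprime)
  open import Data.Integer as ℤ using (+_; -[1+_])
  import Data.Integer.Properties as ℤ
  open import Data.Rational as ℚ using (mkℚ; ceiling; toℚᵘ)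
  open import Data.Rational.Properties using (toℚᵘ-fromℚᵘ; toℚᵘ-mono-≤)
  open import Data.Rational.Unnormalised as ℚᵘ using (mkℚᵘ; *≤*; *≡*)
  import Data.Rational.Unnormalised.Properties as ℚᵘ
  open import Function using (_∘_)
  open import Relation.Nullary using (yes; no; contradiction)
  open import Relation.Binary.PropositionalEquality

  infixl 7 _⌈/⌉_

  -- The same case split on m % n as in ℤ._/ℕ_, so that ceiling-mkℚ holds by computation.
  _⌈/⌉_ : ℕ → (n : ℕ) → .{{NonZero n}} → ℕ
  m ⌈/⌉ n with m % n
  ... | zero  = m / n
  ... | suc _ = suc (m / n)

  m≤[m⌈/⌉n]*n : (m n : ℕ) .{{_ : NonZero n}} → m ≤ m ⌈/⌉ n * n
  m≤[m⌈/⌉n]*n m n with m % n | m≡m%n+[m/n]*n m n | m%n<n m n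
  ... | zero  | m≡ | _   = ≤-reflexive m≡
  ... | suc r | m≡ | r<n = subst (_≤ suc (m / n) * n) (sym m≡) (+-monoˡ-≤ (m / n * n) (<⇒≤ r<n))

  m≤k*n⇒m⌈/⌉n≤k : (m n k : ℕ) .{{_ : NonZero n}} → m ≤ k * n → m ⌈/⌉ n ≤ k
  m≤k*n⇒m⌈/⌉n≤k m n k m≤kn with m % n | m≡m%n+[m/n]*n m n
  ... | zero  | m≡ = *-cancelʳ-≤ (m / n) k n (subst (_≤ k * n) m≡ m≤kn)
  ... | suc r | m≡ with suc (m / n) ℕ.≤? k
  ...   | yes m/n<k = m/n<k
  ...   | no  m/n≮k = contradiction m≤kn (<⇒≱ (begin-strict
    k * n               ≤⟨ *-monoˡ-≤ n (≤-pred (≰⇒> m/n≮k)) ⟩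
    m / n * n           <⟨ s≤s (m≤n+m _ r) ⟩
    suc r ℕ.+ m / n * n ≡⟨ m≡ ⟨
    m                   ∎))
    where open ≤-Reasoning

  cross-≤ : {a b c d : ℕ} (k : ℕ) .{{_ : NonZero d}} → a * d ≤ c * b → c ≤ k * d → a ≤ k * b
  cross-≤ {a} {b} {c} {d} k ad≤cb c≤kd = *-cancelʳ-≤ a (k * b) d (begin
    a * d       ≤⟨ ad≤cb ⟩
    c * b       ≤⟨ *-monoˡ-≤ b c≤kd ⟩
    k * d * b   ≡⟨ *-assoc k d b ⟩
    k * (d * b) ≡⟨ cong (k *_) (*-comm d b) ⟩
    k * (b * d) ≡⟨ *-assoc k b d ⟨
    k * b * d   ∎)
    where open ≤-Reasoning

  ⌈/⌉-cong : (a b c d : ℕ) .{{_ : NonZero b}} .{{_ : NonZero d}} → a * d ≡ c * b → a ⌈/⌉ b ≡ c ⌈/⌉ d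
  ⌈/⌉-cong a b c d ad≡cb = ≤-antisym
    (m≤k*n⇒m⌈/⌉n≤k a b _ (cross-≤ (c ⌈/⌉ d) (≤-reflexive ad≡cb) (m≤[m⌈/⌉n]*n c d)))
    (m≤k*n⇒m⌈/⌉n≤k c d _ (cross-≤ (a ⌈/⌉ b) (≤-reflexive (sym ad≡cb)) (m≤[m⌈/⌉n]*n a b)))

  -[1+n]/ℕd≡-[1+n⌈/⌉d] : (n d : ℕ) .{{_ : NonZero d}} → -[1+ n ] ℤ./ℕ d ≡ ℤ.- + (suc n ⌈/⌉ d)
  -[1+n]/ℕd≡-[1+n⌈/⌉d] n d with suc n % d
  ... | zero  = refl
  ... | suc _ = refl

  ceiling-mkℚ : (n d : ℕ) .(c : Coprime n (suc d)) → ceiling (mkℚ (+ n) d c) ≡ + (n ⌈/⌉ suc d)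
  ceiling-mkℚ zero    d c = refl
  ceiling-mkℚ (suc n) d c = begin
    ℤ.- (+ 1 ℤ.* (-[1+ n ] ℤ./ℕ suc d)) ≡⟨ cong (ℤ.-_ ∘ (+ 1 ℤ.*_)) (-[1+n]/ℕd≡-[1+n⌈/⌉d] n (suc d)) ⟩
    ℤ.- (+ 1 ℤ.* ℤ.- + k)               ≡⟨ cong ℤ.-_ (ℤ.*-identityˡ (ℤ.- + k)) ⟩
    ℤ.- ℤ.- + k                         ≡⟨ ℤ.neg-involutive (+ k) ⟩
    + k                                 ∎
    where
    open ≡-Reasoning
    k = suc n ⌈/⌉ suc d

  toℚᵘ-frac : (a b : ℕ) → toℚᵘ (frac a (suc b) (λ ())) ℚᵘ.≃ mkℚᵘ (+ a) b
  toℚᵘ-frac a b = toℚᵘ-fromℚᵘ (mkℚᵘ (+ a) b)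

  frac-≤⇒ : (a b c d : ℕ) (b≢0 : b ≢ 0) (d≢0 : d ≢ 0) → frac a b b≢0 ℚ.≤ frac c d d≢0 → a * d ≤ c * b
  frac-≤⇒ a zero    c d       b≢0 _   _  = contradiction refl b≢0
  frac-≤⇒ a (suc b) c zero    _   d≢0 _  = contradiction refl d≢0
  frac-≤⇒ a (suc b) c (suc d) _   _   le
    with ℚᵘ.≤-respˡ-≃ (toℚᵘ-frac a b) (ℚᵘ.≤-respʳ-≃ (toℚᵘ-frac c d) (toℚᵘ-mono-≤ le))
  ... | *≤* ad≤cb = ℤ.drop‿+≤+ (subst₂ ℤ._≤_ (sym (ℤ.pos-* a (suc d))) (sym (ℤ.pos-* c (suc b))) ad≤cb)

  ceiling-frac : (a b : ℕ) .{{_ : NonZero b}} → ceiling (frac a b (≢-nonZero⁻¹ b)) ≡ + (a ⌈/⌉ b)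
  ceiling-frac a (suc b) with frac a (suc b) (≢-nonZero⁻¹ (suc b)) | toℚᵘ-frac a b
  ... | mkℚ (+ n) d c | *≡* nb≡ad = trans (ceiling-mkℚ n d c) (cong +_ (⌈/⌉-cong n (suc d) a (suc b)
    (ℤ.+-injective (trans (ℤ.pos-* n (suc b)) (trans nb≡ad (sym (ℤ.pos-* a (suc d))))))))
  ... | mkℚ -[1+ n ] d c | *≡* nb≡ad = contradiction (trans nb≡ad (sym (ℤ.pos-* a (suc d)))) λ ()

module EdgeDensity where

  open Orientations
  open CeilingDivision
  open import Data.Nat as ℕ using (ℕ; _≤_; _<_; NonZero; ≢-nonZero⁻¹; z≤n; s≤s)
  open import Data.Nat.Properties using (≤-trans)
  open import Data.Fin.Subset using (∣_∣)
  open import Data.Vec using (replicate)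
  open import Data.List.Relation.Unary.All as All using (All)
  open import Data.Rational as ℚ using ()
  open import Relation.Nullary using (yes; no)
  open import Relation.Binary.PropositionalEquality

  hallCondition-⌈/⌉ : {n : ℕ} (H : Hypergraph n) (a b : ℕ) .{{_ : NonZero b}} →
    (∀ X (X≢∅ : ∣ X ∣ ≢ 0) → frac (eCount H X) ∣ X ∣ X≢∅ ℚ.≤ frac a b (≢-nonZero⁻¹ b)) →
    HallCondition (Hypergraph.edges H) (replicate n (a ⌈/⌉ b))
  hallCondition-⌈/⌉ H a b below X with ∣ X ∣ ℕ.≟ 0
  ... | yes ∣X∣≡0 = subst (_≤ _) (sym (∣X∣≡0⇒edgeCount≡0 nonempty ∣X∣≡0)) z≤n
    where
    nonempty : All (λ e → 0 < ∣ e ∣) (Hypergraph.edges H)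
    nonempty = All.map (≤-trans (s≤s z≤n)) (Hypergraph.edgesBig H)
  ... | no  ∣X∣≢0 = subst (eCount H X ≤_) (sym (sumOver-replicate (a ⌈/⌉ b) X))
    (cross-≤ (a ⌈/⌉ b) (frac-≤⇒ (eCount H X) ∣ X ∣ a b ∣X∣≢0 (≢-nonZero⁻¹ b) (below X ∣X∣≢0)) (m≤[m⌈/⌉n]*n a b))

module Expansion {c ℓ : Level} (F : CommutativeRing c ℓ) where

  open Orientations using (Orientation; indeg; unit; maxEntry; sum-indeg)
  open import Data.Nat as ℕ using (ℕ; suc; _≤_; s≤s)
  open import Data.Nat.Properties using (≤-reflexive)
  open import Data.Fin using (Fin)
  open import Data.Fin.Subset using (Subset; _∈_)
  open import Data.Fin.Subset.Properties using (_∈?_)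
  open import Data.Vec using (zipWith)
  open import Data.Vec.Properties using (≡-dec)
  open import Data.List as L using (List; []; _∷_; length; filter; allFin)
  open import Data.List.Relation.Binary.Pointwise using ([]; _∷_; Pointwise-length)
  open import Data.List.Relation.Unary.All as All using (All; []; _∷_)
  import Data.List.Relation.Unary.All.Properties as All
  open import Data.List.Relation.Unary.Any as Any using (Any; here; there)
  import Data.List.Relation.Unary.Any.Properties as Any
  open import Data.List.Membership.Propositional.Properties using (∈-filter⁺; ∈-allFin)
  open import Data.Product using (∃; _×_; _,_; proj₁; proj₂)
  open import Function using (_∘_)
  open import Relation.Nullary using (¬_; yes; no; contradiction)
  open import Relation.Binary.PropositionalEquality
  open CommutativeRing F using (Carrier; _≈_; 0#; 1#; _*_; *-cong; *-identityˡ; +-cong)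
    renaming (refl to ≈-refl; sym to ≈-sym; trans to ≈-trans)
  open Poly F

  private variable
    n : ℕ

  Term : ℕ → Set c
  Term n = Carrier × Exponent n

  module _ {p q r} {P : Term n → Set p} {Q : Term n → Set q} {R : Term n → Set r}
    (combine : ∀ {s t} → P s → Q t → R (proj₁ s * proj₁ t , zipWith ℕ._+_ (proj₂ s) (proj₂ t))) where

    All-⊗ : {f g : Poly n} → All P f → All Q g → All R (f ⊗ g)
    All-⊗ Pf Qg = All.concat⁺ (All.map⁺ (All.map (λ Ps → All.map⁺ (All.map (combine Ps) Qg)) Pf))

    Any-⊗ : {f g : Poly n} → Any P f → Any Q g → Any R (f ⊗ g)
    Any-⊗ Pf Qg = Any.concat⁺ (Any.map⁺ (Any.map (λ Ps → Any.map⁺ (Any.map (combine Ps) Qg)) Pf))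

  sumP-map-var : (vs : List (Fin n)) → sumP (L.map var vs) ≡ L.map (λ v → 1# , unit v) vs
  sumP-map-var []       = refl
  sumP-map-var (v ∷ vs) = cong (_ ∷_) (sumP-map-var vs)

  linForm-terms : (e : Subset n) →
                  All (λ t → proj₁ t ≈ 1# × ∃ λ v → v ∈ e × proj₂ t ≡ unit v) (linForm F e)
  linForm-terms {n} e = subst (All _) (sym (sumP-map-var (filter (_∈? e) (allFin n))))
    (All.map⁺ (All.map (λ v∈e → ≈-refl , _ , v∈e , refl) (All.all-filter (_∈? e) (allFin n))))

  linForm-has : {e : Subset n} {v : Fin n} → v ∈ e → Any (λ t → proj₂ t ≡ unit v) (linForm F e)
  linForm-has {n} {e} {v} v∈e = subst (Any _) (sym (sumP-map-var (filter (_∈? e) (allFin n))))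
    (Any.map⁺ (Any.map (λ { refl → refl }) (∈-filter⁺ (_∈? e) (∈-allFin v) v∈e)))

  edgeProduct : List (Subset n) → Poly n
  edgeProduct es = prodP (L.map (linForm F) es)

  edgeProduct-terms : (es : List (Subset n)) →
    All (λ t → proj₁ t ≈ 1# × ∃ λ vs → Orientation es vs × indeg vs ≡ proj₂ t) (edgeProduct es)
  edgeProduct-terms []       = (≈-refl , [] , [] , refl) ∷ []
  edgeProduct-terms (e ∷ es) = All-⊗ combine (linForm-terms e) (edgeProduct-terms es)
    where
    combine : ∀ {s t} → proj₁ s ≈ 1# × (∃ λ v → v ∈ e × proj₂ s ≡ unit v) →
              proj₁ t ≈ 1# × (∃ λ vs → Orientation es vs × indeg vs ≡ proj₂ t) →
              proj₁ s * proj₁ t ≈ 1# ×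
              ∃ λ vs → Orientation (e ∷ es) vs × indeg vs ≡ zipWith ℕ._+_ (proj₂ s) (proj₂ t)
    combine (s≈1 , v , v∈e , refl) (t≈1 , vs , orient , refl) =
      ≈-trans (*-cong s≈1 t≈1) (*-identityˡ 1#) , v ∷ vs , v∈e ∷ orient , refl

  edgeProduct-has : {es : List (Subset n)} {vs : List (Fin n)} → Orientation es vs →
                    Any (λ t → proj₂ t ≡ indeg vs) (edgeProduct es)
  edgeProduct-has []             = here refl
  edgeProduct-has (v∈e ∷ orient) = Any-⊗ (λ { refl refl → refl }) (linForm-has v∈e) (edgeProduct-has orient)

  coeff-absent : (f : Poly n) (α : Exponent n) → ¬ Any (λ t → proj₂ t ≡ α) f → coeff f α ≈ 0#
  coeff-absent []            α _      = ≈-refl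
  coeff-absent ((a , β) ∷ f) α absent with ≡-dec ℕ._≟_ β α
  ... | yes β≡α = contradiction (here β≡α) absent
  ... | no  _   = coeff-absent f α (absent ∘ there)

  coeff-ones : (f : Poly n) (α : Exponent n) → All (λ t → proj₁ t ≈ 1#) f →
               ∃ λ k → coeff f α ≈ natToR F k
  coeff-ones []            α []           = 0 , ≈-refl
  coeff-ones ((a , β) ∷ f) α (a≈1 ∷ ones) with ≡-dec ℕ._≟_ β α | coeff-ones f α ones
  ... | yes _ | k , coeff≈k = suc k , +-cong a≈1 coeff≈k
  ... | no  _ | k , coeff≈k = k , coeff≈k

  coeff-present : (f : Poly n) (α : Exponent n) → All (λ t → proj₁ t ≈ 1#) f →
                  Any (λ t → proj₂ t ≡ α) f → ∃ λ k → coeff f α ≈ natToR F (suc k)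
  coeff-present ((a , β) ∷ f) α (a≈1 ∷ ones) present with ≡-dec ℕ._≟_ β α
  ... | yes _ = let k , coeff≈k = coeff-ones f α ones in k , +-cong a≈1 coeff≈k
  ... | no β≢α with present
  ...   | here β≡α       = contradiction β≡α β≢α
  ...   | there present′ = coeff-present f α ones present′

  edgeProduct-coeff≉0 : CharZero F → {es : List (Subset n)} {vs : List (Fin n)} → Orientation es vs →
                        ¬ coeff (edgeProduct es) (indeg vs) ≈ 0#
  edgeProduct-coeff≉0 charZero {es} orient
    with coeff-present (edgeProduct es) _ (All.map proj₁ (edgeProduct-terms es)) (edgeProduct-has orient)
  ... | k , coeff≈1+k = λ coeff≈0 → charZero k (≈-trans (≈-sym coeff≈1+k) coeff≈0)

  edgeProduct-support : (es : List (Subset n)) {α : Exponent n} → ¬ coeff (edgeProduct es) α ≈ 0# →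
                        ∃ λ vs → Orientation es vs × indeg vs ≡ α
  edgeProduct-support es {α} coeff≉0 with Any.any? (λ t → ≡-dec ℕ._≟_ (proj₂ t) α) (edgeProduct es)
  ... | no  absent  = contradiction (coeff-absent (edgeProduct es) α absent) coeff≉0
  ... | yes present with All.lookupAny (edgeProduct-terms es) present
  ...   | (_ , vs , orient , indeg≡) , ≡α = vs , orient , trans indeg≡ ≡α

  edgeProduct-IsAT : CharZero F → (es : List (Subset n)) (K : ℕ) →
    (∃ λ vs → Orientation es vs × maxEntry (indeg vs) ≡ K) →
    (∀ {vs} → Orientation es vs → K ≤ maxEntry (indeg vs)) →
    IsAT (edgeProduct es) (suc K)
  edgeProduct-IsAT charZero es K (vs₀ , orient₀ , max≡K) K≤max =
    length es , ((indeg vs₀ , inS₀) , degree≤) , (indeg vs₀ , inS₀ , cong suc max≡K) , minimal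
    where
    totalDeg-indeg : ∀ {vs} → Orientation es vs → totalDeg (indeg vs) ≡ length es
    totalDeg-indeg {vs} orient = trans (sum-indeg vs) (sym (Pointwise-length orient))
    inS₀ : InS (edgeProduct es) (length es) (indeg vs₀)
    inS₀ = totalDeg-indeg orient₀ , edgeProduct-coeff≉0 charZero orient₀
    degree≤ : ∀ α → ¬ coeff (edgeProduct es) α ≈ 0# → totalDeg α ≤ length es
    degree≤ α coeff≉0 with edgeProduct-support es coeff≉0
    ... | vs , orient , refl = ≤-reflexive (totalDeg-indeg orient)
    minimal : ∀ α → InS (edgeProduct es) (length es) α → suc K ≤ suc (maxExp α)
    minimal α (_ , coeff≉0) with edgeProduct-support es coeff≉0
    ... | vs , orient , refl = s≤s (K≤max orient)

open Orientations using (Orientation; indeg; maxEntry; edgeCount-≤-maxIndeg; hallCondition⇒orientation; ≤ᵛ⇒maxEntry-≤)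
open CeilingDivision using (_⌈/⌉_; m≤k*n⇒m⌈/⌉n≤k; ceiling-frac)
open EdgeDensity using (hallCondition-⌈/⌉)
open Expansion using (edgeProduct-IsAT)

open import Data.Nat using (ℕ; suc; _≤_; NonZero; ≢-nonZero)
open import Data.Nat.Properties using (≤-antisym; +-comm)
open import Data.Integer using (+_; _+_)
open import Data.Rational using (ℚ; ceiling)
open import Data.Fin.Subset using (Subset; ∣_∣)
open import Data.Vec using (replicate)
open import Data.List using (List)
open import Data.Product using (Σ; ∃; _×_; _,_)
open import Relation.Binary.PropositionalEquality using (_≡_; refl; cong; trans; sym)

lemma2p2 : ∀ {c ℓ : Level} (F : CommutativeRing c ℓ) → IsField F → CharZero F →
    ∀ (n : ℕ) (H : Hypergraph n) (q : ℚ) → IsEd H q →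
    Σ ℕ λ a → Poly.IsAT F (pbar F H) a × (+ a ≡ ceiling q + + 1)
-- Only characteristic zero is used: the coefficients of p̄_H are positive integers.
lemma2p2 F _ charZero n H q ((X₀ , X₀≢∅ , refl) , below) =
  suc K , edgeProduct-IsAT F charZero es K optimal K≤maxIndeg , ceiling≡K
  where
  instance
    X₀-nonZero : NonZero ∣ X₀ ∣
    X₀-nonZero = ≢-nonZero X₀≢∅
  es : List (Subset n)
  es = Hypergraph.edges H
  K : ℕ
  K = eCount H X₀ ⌈/⌉ ∣ X₀ ∣
  K≤maxIndeg : ∀ {vs} → Orientation es vs → K ≤ maxEntry (indeg vs)
  K≤maxIndeg orient = m≤k*n⇒m⌈/⌉n≤k _ _ _ (edgeCount-≤-maxIndeg orient X₀)
  optimal : ∃ λ vs → Orientation es vs × maxEntry (indeg vs) ≡ K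
  optimal with hallCondition⇒orientation es (replicate n K) (hallCondition-⌈/⌉ H (eCount H X₀) ∣ X₀ ∣ below)
  ... | vs , orient , indeg≤K = vs , orient , ≤-antisym (≤ᵛ⇒maxEntry-≤ indeg≤K) (K≤maxIndeg orient)
  ceiling≡K : + suc K ≡ ceiling q + + 1
  ceiling≡K = trans (cong +_ (+-comm 1 K)) (cong (_+ + 1) (sym (ceiling-frac (eCount H X₀) ∣ X₀ ∣)))
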